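{- There is a polynomial $q$ such that for all disjoint index sets $P,N$ the following holds: there is a boolean CPS proof over $\mathbb{Z}$ of size at most $q(|P|+|N|)$ of $\sum_{i\in P}x_i+\sum_{j\in N}(1-x_j)-1\ge0$ from the two inequalities $\prod_{i\in P}(1-x_i)\cdot\prod_{j\in N}x_j\ge0$ and $-\prod_{i\in P}(1-x_i)\cdot\prod_{j\in N}x_j\ge0$ (together with the boolean axioms).
   Context: A squaring gate is a product gate whose two inputs come from the same node; a circuit $C(\bar x,\bar y)$ is $\bar y$-conic if every leaf labelled by a negative constant or an $x$-variable has all its paths to the output passing through a squaring gate. Boolean CPS: the list of assumed inequalities $h_1\ge0,\dots,h_\ell\ge0$ contains the given ones together with $x_i\ge0$, $1-x_i\ge0$, $x_i^2-x_i\ge0$ and $-(x_i^2-x_i)\ge0$ for every variable $x_i$; a CPS proof of $p\ge 0$ is a $\bar y$-conic circuit $C(\bar x,y_1,\dots,y_\ell)$ with $C(\bar x,h_1,\dots,h_\ell)=p$ as a formal polynomial identity; size = number of nodes of $C$. The products $\prod(1-x_i)\prod x_j$ are written as circuits without multiplying out. -}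

module Defs where

open import Level using (0ℓ)
open import Data.Nat as ℕ using (ℕ; zero; suc; _∸_)
open import Data.Integer as ℤ using (ℤ; +_; -[1+_]; 0ℤ)
open import Data.Fin as Fin using (Fin; zero; suc)
open import Data.Fin.Subset using (Subset; _∈_; ∣_∣)
open import Data.Bool using (Bool; true; false)
open import Data.Vec using ([]; _∷_)
open import Data.List using (List; []; _∷_; _++_; [_]; length)
open import Data.Maybe using (Maybe; just; nothing)
open import Data.Product using (Σ; ∃; _×_; _,_)
open import Data.Sum using (_⊎_)
open import Data.Unit using (⊤)
open import Data.Empty using (⊥)
open import Relation.Binary.PropositionalEquality using (_≡_)
open import Relation.Nullary using (¬_)
open import Algebra.Bundles using (CommutativeRing)

-- Polynomials with natural-number coefficients (used for the size bound)
-- evalPoly (a₀ ∷ a₁ ∷ … ∷ a_d ∷ []) m = a₀ + a₁ m + … + a_d m^d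

evalPoly : List ℕ → ℕ → ℕ
evalPoly []       m = 0
evalPoly (a ∷ as) m = a ℕ.+ m ℕ.* evalPoly as m

Disjoint : ∀ {n} → Subset n → Subset n → Set
Disjoint P N = ∀ i → i ∈ P → i ∈ N → ⊥

-- Labels of the assumed inequalities h_j ≥ 0 (the y-variables) of the
-- boolean CPS over variables x_0 … x_{n-1}:
--   hypPos : ∏_{i∈P}(1-x_i) ∏_{j∈N} x_j ≥ 0
--   hypNeg : -∏_{i∈P}(1-x_i) ∏_{j∈N} x_j ≥ 0
--   bNonneg i : x_i ≥ 0,  bUpper i : 1 - x_i ≥ 0,
--   bSq i : x_i² - x_i ≥ 0,  bNegSq i : -(x_i² - x_i) ≥ 0

data Ax (n : ℕ) : Set where
  hypPos hypNeg : Ax n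
  bNonneg bUpper bSq bNegSq : Fin n → Ax n

-- Circuits C(x̄, ȳ) over ℤ, as a list of nodes in topological order.
-- Node k is the k-th element of the list; gate inputs are node indices.
-- The output is the last node. Size = number of nodes.

data Gate (n : ℕ) : Set where
  xvar  : Fin n → Gate n
  yvar  : Ax n → Gate n
  const : ℤ → Gate n
  plus  : ℕ → ℕ → Gate n
  times : ℕ → ℕ → Gate n

InputsBelow : ∀ {n} → ℕ → Gate n → Set
InputsBelow k (plus a b)  = a ℕ.< k × b ℕ.< k
InputsBelow k (times a b) = a ℕ.< k × b ℕ.< k
InputsBelow k _           = ⊤

WellFormedFrom : ∀ {n} → ℕ → List (Gate n) → Set
WellFormedFrom k []       = ⊤
WellFormedFrom k (g ∷ gs) = InputsBelow k g × WellFormedFrom (suc k) gs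

record Circuit (n : ℕ) : Set where
  field
    gates     : List (Gate n)
    nonempty  : 1 ℕ.≤ length gates
    wellForm  : WellFormedFrom 0 gates

open Circuit public

size : ∀ {n} → Circuit n → ℕ
size C = length (gates C)

outNode : ∀ {n} → Circuit n → ℕ
outNode C = length (gates C) ∸ 1

gateAt : ∀ {n} → List (Gate n) → ℕ → Maybe (Gate n)
gateAt []       k       = nothing
gateAt (g ∷ gs) zero    = just g
gateAt (g ∷ gs) (suc k) = gateAt gs k

IsInputOf : ∀ {n} → ℕ → Gate n → Set
IsInputOf i (plus a b)  = i ≡ a ⊎ i ≡ b
IsInputOf i (times a b) = i ≡ a ⊎ i ≡ b
IsInputOf i _           = ⊥

Edge : ∀ {n} → Circuit n → ℕ → ℕ → Set
Edge C i j = Σ (Gate _) λ g → gateAt (gates C) j ≡ just g × IsInputOf i g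

IsSquaring : ∀ {n} → Circuit n → ℕ → Set
IsSquaring C j = Σ ℕ λ a → gateAt (gates C) j ≡ just (times a a)

IsBadLeaf : ∀ {n} → Circuit n → ℕ → Set
IsBadLeaf C u = (Σ ℤ λ c → gateAt (gates C) u ≡ just (const c) × c ℤ.< 0ℤ)
              ⊎ (Σ (Fin _) λ i → gateAt (gates C) u ≡ just (xvar i))

data AvoidingPath {n} (C : Circuit n) : ℕ → ℕ → Set where
  here : ∀ {u} → ¬ IsSquaring C u → AvoidingPath C u u
  step : ∀ {u w v} → ¬ IsSquaring C u → Edge C u w → AvoidingPath C w v →
         AvoidingPath C u v

Conic : ∀ {n} → Circuit n → Set
Conic C = ∀ u → IsBadLeaf C u → ¬ AvoidingPath C u (outNode C)

-- Semantics in an arbitrary commutative ring (formal identities over ℤ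
-- are identities in every commutative ring, e.g. in ℤ[x̄] itself)

module Sem (R : CommutativeRing 0ℓ 0ℓ) where
  open CommutativeRing R using (Carrier; _+_; _*_; -_; 0#; 1#)

  _−_ : Carrier → Carrier → Carrier
  a − b = a + (- b)

  natR : ℕ → Carrier
  natR zero    = 0#
  natR (suc k) = 1# + natR k

  intR : ℤ → Carrier
  intR (+ k)     = natR k
  intR -[1+ k ]  = - natR (suc k)

  nth : List Carrier → ℕ → Carrier
  nth []       k       = 0#
  nth (v ∷ vs) zero    = v
  nth (v ∷ vs) (suc k) = nth vs k

  module _ {n : ℕ} (ρx : Fin n → Carrier) (ρy : Ax n → Carrier) where
    evalGate : List Carrier → Gate n → Carrier
    evalGate vs (xvar i)    = ρx i
    evalGate vs (yvar j)    = ρy j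
    evalGate vs (const c)   = intR c
    evalGate vs (plus a b)  = nth vs a + nth vs b
    evalGate vs (times a b) = nth vs a * nth vs b

    evalFrom : List Carrier → List (Gate n) → List Carrier
    evalFrom vs []       = vs
    evalFrom vs (g ∷ gs) = evalFrom (vs ++ [ evalGate vs g ]) gs

    evalCircuit : Circuit n → Carrier
    evalCircuit C = nth (evalFrom [] (gates C)) (outNode C)

  sumSub : ∀ {n} → Subset n → (Fin n → Carrier) → Carrier
  sumSub []          f = 0#
  sumSub (true  ∷ p) f = f Fin.zero + sumSub p (λ i → f (suc i))
  sumSub (false ∷ p) f = sumSub p (λ i → f (suc i))

  prodSub : ∀ {n} → Subset n → (Fin n → Carrier) → Carrier
  prodSub []          f = 1#
  prodSub (true  ∷ p) f = f Fin.zero * prodSub p (λ i → f (suc i))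
  prodSub (false ∷ p) f = prodSub p (λ i → f (suc i))

  axVal : ∀ {n} → Subset n → Subset n → (Fin n → Carrier) → Ax n → Carrier
  axVal P N ρ hypPos      = prodSub P (λ i → 1# − ρ i) * prodSub N ρ
  axVal P N ρ hypNeg      = - (prodSub P (λ i → 1# − ρ i) * prodSub N ρ)
  axVal P N ρ (bNonneg i) = ρ i
  axVal P N ρ (bUpper i)  = 1# − ρ i
  axVal P N ρ (bSq i)     = (ρ i * ρ i) − ρ i
  axVal P N ρ (bNegSq i)  = - ((ρ i * ρ i) − ρ i)

  target : ∀ {n} → Subset n → Subset n → (Fin n → Carrier) → Carrier
  target P N ρ = (sumSub P ρ + sumSub N (λ j → 1# − ρ j)) − 1#

record BoolCPSProof (n : ℕ) (P N : Subset n) : Set₁ where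
  field
    circuit  : Circuit n
    conic    : Conic circuit
    identity : (R : CommutativeRing 0ℓ 0ℓ) (ρ : Fin n → CommutativeRing.Carrier R) →
               CommutativeRing._≈_ R
                 (Sem.evalCircuit R ρ (Sem.axVal R P N ρ) circuit)
                 (Sem.target R P N ρ)

-- Every literal ℓ (x_i for i ∈ P, 1 − x_j for j ∈ N) comes with its complement ℓ̄ = 1 − ℓ, and
-- both ℓ ≥ 0 and ℓ̄ ≥ 0 are boolean axioms.  Let A be the product of the complements ℓ̄ and
-- S the sum of the literals ℓ seen so far.  The circuit keeps two nodes D = 1 − A and
-- E = S + A − 1 (initially both 0, for A = 1 and S = 0) and processes one literal with six gates,
-- D ↦ ℓ + ℓ̄·D and E ↦ E + ℓ·D, which re-establish both equations for A·ℓ̄ and S + ℓ.  At the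
-- end A is the hypothesis polynomial, so adding the hypothesis −A ≥ 0 to E yields the target
-- S − 1.  The circuit has no x-leaves and no negative constants, so it is conic without using a
-- single squaring gate, and its size is 6(|P| + |N|) + 5.

module Submission where

open import Defs
open import Data.Nat using (ℕ; _≤_; _+_)
open import Data.List using (List)
open import Data.Product using (Σ)
open import Data.Fin.Subset using (Subset; ∣_∣)

open import Level using (0ℓ)
open import Data.Nat using (zero; suc; _*_; _∸_; _<_; _<ᵇ_; z≤n; s≤s)
import Data.Nat.Properties as ℕP
open import Data.Nat.Tactic.RingSolver using (solve-∀)
open import Data.Integer as ℤ using (0ℤ)
import Data.Integer.Properties as ℤP
open import Data.Fin using (Fin; zero; suc)
open import Data.Bool using (true; false; T)
open import Data.Vec using ([]; _∷_)
open import Data.List using ([]; _∷_; _++_; [_]; length; map)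
open import Data.List.Properties using (length-++; ++-assoc)
open import Data.List.Relation.Unary.All using (All; []; _∷_)
open import Data.List.Relation.Unary.All.Properties using (++⁺)
open import Data.Maybe using (just)
open import Data.Product using (_×_; _,_; proj₁; proj₂)
open import Data.Sum using (inj₁; inj₂)
open import Data.Unit using (⊤; tt)
open import Data.Empty using (⊥)
open import Relation.Binary.PropositionalEquality
  using (_≡_; refl; sym; trans; cong; cong₂; subst; module ≡-Reasoning)
open import Algebra.Bundles using (CommutativeRing)
import Algebra.Solver.Ring.NaturalCoefficients.Default as SemiringSolver

shiftGate : ∀ {n} → ℕ → Gate n → Gate n
shiftGate m (plus a b)  = plus (m + a) (m + b)
shiftGate m (times a b) = times (m + a) (m + b)
shiftGate m g           = g

place : ∀ {n} → ℕ → List (Gate n) → List (Gate n)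
place m = map (shiftGate m)

WellFormedFrom-++ : ∀ {n} k (gs hs : List (Gate n)) →
  WellFormedFrom k gs → WellFormedFrom (length gs + k) hs → WellFormedFrom k (gs ++ hs)
WellFormedFrom-++ k []       hs _        wf = wf
WellFormedFrom-++ k (g ∷ gs) hs (g<k , wf-gs) wf =
  g<k , WellFormedFrom-++ (suc k) gs hs wf-gs
          (subst (λ j → WellFormedFrom j hs) (sym (ℕP.+-suc (length gs) k)) wf)

InputsBelow-shift : ∀ {n} m k (g : Gate n) → InputsBelow k g → InputsBelow (m + k) (shiftGate m g)
InputsBelow-shift m k (xvar i)    tt            = tt
InputsBelow-shift m k (yvar j)    tt            = tt
InputsBelow-shift m k (const c)   tt            = tt
InputsBelow-shift m k (plus a b)  (a<k , b<k)   = ℕP.+-monoʳ-< m a<k , ℕP.+-monoʳ-< m b<k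
InputsBelow-shift m k (times a b) (a<k , b<k)   = ℕP.+-monoʳ-< m a<k , ℕP.+-monoʳ-< m b<k

WellFormedFrom-place : ∀ {n} m k (gs : List (Gate n)) →
  WellFormedFrom k gs → WellFormedFrom (m + k) (place m gs)
WellFormedFrom-place m k []       tt           = tt
WellFormedFrom-place m k (g ∷ gs) (g<k , wf) =
  InputsBelow-shift m k g g<k ,
  subst (λ j → WellFormedFrom j (place m gs)) (ℕP.+-suc m k) (WellFormedFrom-place m (suc k) gs wf)

NotBadLeaf : ∀ {n} → Gate n → Set
NotBadLeaf (xvar _)  = ⊥
NotBadLeaf (const c) = 0ℤ ℤ.≤ c
NotBadLeaf _         = ⊤

gateAt-All : ∀ {n} {Q : Gate n → Set} {gs u g} → All Q gs → gateAt gs u ≡ just g → Q g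
gateAt-All {u = zero}  (q ∷ _)  refl = q
gateAt-All {u = suc u} (_ ∷ qs) eq   = gateAt-All qs eq

conic-without-bad-leaves : ∀ {n} (C : Circuit n) → All NotBadLeaf (gates C) → Conic C
conic-without-bad-leaves C ok u (inj₁ (c , at , c<0)) _ = ℤP.<⇒≱ c<0 (gateAt-All ok at)
conic-without-bad-leaves C ok u (inj₂ (i , at))       _ = gateAt-All ok at

positive negative : ∀ {n} → Fin n → Ax n × Ax n
positive i = bNonneg i , bUpper i
negative i = bUpper i , bNonneg i

frame₀ : ∀ {n} → List (Gate n)
frame₀ = const 0ℤ ∷ const 0ℤ ∷ const 0ℤ ∷ []

-- Nodes 0, 1, 2 hold D, a scratch value and E; nodes 6, 7, 8 hold their successors.
block₀ : ∀ {n} → Ax n × Ax n → List (Gate n)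
block₀ (b , a) = yvar b ∷ yvar a ∷ times 4 0 ∷ plus 3 5 ∷ times 3 0 ∷ plus 2 7 ∷ []

conclusion₀ : ∀ {n} → List (Gate n)
conclusion₀ = yvar hypNeg ∷ plus 2 3 ∷ []

blocks : ∀ {n k} → (Fin k → Ax n × Ax n) → Subset k → ℕ → List (Gate n)
blocks lit []          m = []
blocks lit (true  ∷ p) m = place m (block₀ (lit zero)) ++ blocks (λ i → lit (suc i)) p (6 + m)
blocks lit (false ∷ p) m = blocks (λ i → lit (suc i)) p m

<-byᵇ : ∀ m n → {T (m <ᵇ n)} → m < n
<-byᵇ m n {m<n} = ℕP.<ᵇ⇒< m n m<n

WellFormedFrom-block₀ : ∀ {n} (ba : Ax n × Ax n) → WellFormedFrom 3 (block₀ ba)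
WellFormedFrom-block₀ ba =
  tt , tt , (<-byᵇ 4 5 , <-byᵇ 0 5) , (<-byᵇ 3 6 , <-byᵇ 5 6) , (<-byᵇ 3 7 , <-byᵇ 0 7) ,
  (<-byᵇ 2 8 , <-byᵇ 7 8) , tt

WellFormedFrom-conclusion₀ : ∀ {n} → WellFormedFrom 3 (conclusion₀ {n})
WellFormedFrom-conclusion₀ = tt , (<-byᵇ 2 4 , <-byᵇ 3 4) , tt

+-six-shift : ∀ m k → m + (6 + k) ≡ 6 + m + k
+-six-shift = solve-∀

length-blocks : ∀ {n k} (lit : Fin k → Ax n × Ax n) P m → length (blocks lit P m) ≡ ∣ P ∣ * 6
length-blocks lit []          m = refl
length-blocks lit (true  ∷ p) m = cong (6 +_) (length-blocks _ p (6 + m))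
length-blocks lit (false ∷ p) m = length-blocks _ p m

WellFormedFrom-blocks-++ : ∀ {n k} (lit : Fin k → Ax n × Ax n) P m {hs : List (Gate n)} →
  WellFormedFrom (m + ∣ P ∣ * 6 + 3) hs → WellFormedFrom (m + 3) (blocks lit P m ++ hs)
WellFormedFrom-blocks-++ lit []          m {hs} wf =
  subst (λ j → WellFormedFrom (j + 3) hs) (ℕP.+-identityʳ m) wf
WellFormedFrom-blocks-++ lit (true  ∷ p) m {hs} wf =
  WellFormedFrom-++ (m + 3) (place m (block₀ (lit zero))) _
    (WellFormedFrom-place m 3 (block₀ (lit zero)) (WellFormedFrom-block₀ (lit zero)))
    (WellFormedFrom-blocks-++ _ p (6 + m)
      (subst (λ j → WellFormedFrom (j + 3) hs) (+-six-shift m (∣ p ∣ * 6)) wf))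
WellFormedFrom-blocks-++ lit (false ∷ p) m wf = WellFormedFrom-blocks-++ _ p m wf

NotBadLeaf-blocks : ∀ {n k} (lit : Fin k → Ax n × Ax n) P m → All NotBadLeaf (blocks lit P m)
NotBadLeaf-blocks lit []          m = []
NotBadLeaf-blocks lit (true  ∷ p) m =
  ++⁺ (tt ∷ tt ∷ tt ∷ tt ∷ tt ∷ tt ∷ []) (NotBadLeaf-blocks _ p (6 + m))
NotBadLeaf-blocks lit (false ∷ p) m = NotBadLeaf-blocks _ p m

module Evaluation (R : CommutativeRing 0ℓ 0ℓ) {n : ℕ}
                  (ρx : Fin n → CommutativeRing.Carrier R) (ρy : Ax n → CommutativeRing.Carrier R) where
  open CommutativeRing R
    using (Carrier; 1#; -_; _≈_; setoid; commutativeSemiring; +-cong; *-cong;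
           +-assoc; *-assoc; +-identityʳ; *-identityʳ; -‿inverseʳ)
    renaming (_+_ to _⊕_; _*_ to _⊗_; refl to ≈-refl; sym to ≈-sym; trans to ≈-trans)
  open Sem R using (nth; evalFrom; evalGate; evalCircuit; sumSub; prodSub)
  open SemiringSolver commutativeSemiring using (solve; _:+_; _:*_; _:=_)
  open import Relation.Binary.Reasoning.Setoid setoid

  evaluate : List Carrier → List (Gate n) → List Carrier
  evaluate = evalFrom ρx ρy

  nth-++ʳ : ∀ (xs ys : List Carrier) k → nth (xs ++ ys) (length xs + k) ≡ nth ys k
  nth-++ʳ []       ys k = refl
  nth-++ʳ (x ∷ xs) ys k = nth-++ʳ xs ys k

  evalGate-shift : ∀ pre vs (g : Gate n) →
    evalGate ρx ρy (pre ++ vs) (shiftGate (length pre) g) ≡ evalGate ρx ρy vs g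
  evalGate-shift pre vs (xvar i)    = refl
  evalGate-shift pre vs (yvar j)    = refl
  evalGate-shift pre vs (const c)   = refl
  evalGate-shift pre vs (plus a b)  = cong₂ _⊕_ (nth-++ʳ pre vs a) (nth-++ʳ pre vs b)
  evalGate-shift pre vs (times a b) = cong₂ _⊗_ (nth-++ʳ pre vs a) (nth-++ʳ pre vs b)

  evaluate-place : ∀ pre vs gs → evaluate (pre ++ vs) (place (length pre) gs) ≡ pre ++ evaluate vs gs
  evaluate-place pre vs []       = refl
  evaluate-place pre vs (g ∷ gs)
    rewrite evalGate-shift pre vs g | ++-assoc pre vs [ evalGate ρx ρy vs g ]
    = evaluate-place pre (vs ++ [ evalGate ρx ρy vs g ]) gs

  evaluate-++ : ∀ vs gs hs → evaluate vs (gs ++ hs) ≡ evaluate (evaluate vs gs) hs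
  evaluate-++ vs []       hs = refl
  evaluate-++ vs (g ∷ gs) hs = evaluate-++ _ gs hs

  length-evaluate : ∀ vs gs → length (evaluate vs gs) ≡ length vs + length gs
  length-evaluate vs []       = sym (ℕP.+-identityʳ (length vs))
  length-evaluate vs (g ∷ gs) =
    trans (length-evaluate (vs ++ [ _ ]) gs)
          (trans (cong (_+ length gs) (length-++ vs)) (ℕP.+-assoc (length vs) 1 (length gs)))

  evalCircuit-snoc : ∀ (C : Circuit n) xs y → evaluate [] (gates C) ≡ xs ++ [ y ] →
                     evalCircuit ρx ρy C ≡ y
  evalCircuit-snoc C xs y eq = trans (cong₂ nth eq out≡) (nth-++ʳ xs [ y ] 0)
    where
    length-gates : length (gates C) ≡ length xs + 1
    length-gates = trans (sym (length-evaluate [] (gates C))) (trans (cong length eq) (length-++ xs))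
    out≡ : outNode C ≡ length xs + 0
    out≡ = trans (cong (_∸ 1) length-gates)
                 (trans (ℕP.m+n∸n≡m (length xs) 1) (sym (ℕP.+-identityʳ (length xs))))

  -- The invariants are stated without subtraction so that each block step is a semiring identity.
  record Frame (m : ℕ) (A S : Carrier) (ws : List Carrier) : Set where
    field
      pre       : List Carrier
      D X E     : Carrier
      shape     : ws ≡ pre ++ D ∷ X ∷ E ∷ []
      offset    : length pre ≡ m
      D+A≈1     : D ⊕ A ≈ 1#
      E+1≈S+A   : E ⊕ 1# ≈ S ⊕ A

  Frame-cong : ∀ {m m′ A A′ S S′ ws} → m ≡ m′ → A ≈ A′ → S ≈ S′ → Frame m A S ws → Frame m′ A′ S′ ws
  Frame-cong m≡ A≈ S≈ fr = record
    { pre = pre ; D = D ; X = X ; E = E ; shape = shape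
    ; offset  = trans offset m≡
    ; D+A≈1   = ≈-trans (+-cong ≈-refl (≈-sym A≈)) D+A≈1
    ; E+1≈S+A = ≈-trans E+1≈S+A (+-cong S≈ A≈)
    }
    where open Frame fr

  Frame-block : ∀ {m A S ws} b a → ρy b ⊕ ρy a ≈ 1# → Frame m A S ws →
                Frame (6 + m) (A ⊗ ρy a) (S ⊕ ρy b) (evaluate ws (place m (block₀ (b , a))))
  Frame-block {A = A} {S} b a b+a≈1
    record { pre = pre ; D = D ; X = X ; E = E ; shape = refl ; offset = refl
           ; D+A≈1 = D+A≈1 ; E+1≈S+A = E+1≈S+A } = record
    { pre     = pre ++ D ∷ X ∷ E ∷ β ∷ α ∷ α ⊗ D ∷ []
    ; shape   = trans (evaluate-place pre (D ∷ X ∷ E ∷ []) (block₀ (b , a))) (sym (++-assoc pre _ _))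
    ; offset  = trans (length-++ pre) (ℕP.+-comm (length pre) 6)
    ; D+A≈1   = begin
        (β ⊕ α ⊗ D) ⊕ A ⊗ α   ≈⟨ solve 4 (λ β α D A → (β :+ α :* D) :+ A :* α := β :+ α :* (D :+ A))
                                        ≈-refl β α D A ⟩
        β ⊕ α ⊗ (D ⊕ A)       ≈⟨ +-cong ≈-refl (≈-trans (*-cong ≈-refl D+A≈1) (*-identityʳ α)) ⟩
        β ⊕ α                  ≈⟨ b+a≈1 ⟩
        1#                     ∎
    ; E+1≈S+A = begin
        (E ⊕ β ⊗ D) ⊕ 1#              ≈⟨ solve 4 (λ E β D u → (E :+ β :* D) :+ u := (E :+ u) :+ β :* D)
                                                ≈-refl E β D 1# ⟩
        (E ⊕ 1#) ⊕ β ⊗ D              ≈⟨ +-cong E+1≈S+A ≈-refl ⟩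
        (S ⊕ A) ⊕ β ⊗ D               ≈⟨ +-cong (+-cong ≈-refl (≈-sym A[β+α]≈A)) ≈-refl ⟩
        (S ⊕ A ⊗ (β ⊕ α)) ⊕ β ⊗ D     ≈⟨ solve 5 (λ S A β α D → (S :+ A :* (β :+ α)) :+ β :* D
                                                           := (S :+ β :* (D :+ A)) :+ A :* α) ≈-refl S A β α D ⟩
        (S ⊕ β ⊗ (D ⊕ A)) ⊕ A ⊗ α     ≈⟨ +-cong (+-cong ≈-refl (≈-trans (*-cong ≈-refl D+A≈1) (*-identityʳ β)))
                                                ≈-refl ⟩
        (S ⊕ β) ⊕ A ⊗ α               ∎
    }
    where
    β = ρy b
    α = ρy a
    A[β+α]≈A : A ⊗ (β ⊕ α) ≈ A
    A[β+α]≈A = ≈-trans (*-cong ≈-refl b+a≈1) (*-identityʳ A)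

  Frame-blocks : ∀ {k m A S ws} (lit : Fin k → Ax n × Ax n) →
    (∀ i → ρy (proj₁ (lit i)) ⊕ ρy (proj₂ (lit i)) ≈ 1#) → ∀ P → Frame m A S ws →
    Frame (m + ∣ P ∣ * 6) (A ⊗ prodSub P (λ i → ρy (proj₂ (lit i))))
          (S ⊕ sumSub P (λ i → ρy (proj₁ (lit i)))) (evaluate ws (blocks lit P m))
  Frame-blocks {m = m} {A} {S} lit compl [] fr =
    Frame-cong (sym (ℕP.+-identityʳ m)) (≈-sym (*-identityʳ A)) (≈-sym (+-identityʳ S)) fr
  Frame-blocks {m = m} {A} {S} lit compl (true ∷ p) fr =
    Frame-cong (sym (+-six-shift m (∣ p ∣ * 6))) (*-assoc A _ _) (+-assoc S _ _)
      (Frame-blocks (λ i → lit (suc i)) (λ i → compl (suc i)) p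
        (Frame-block (proj₁ (lit zero)) (proj₂ (lit zero)) (compl zero) fr))
  Frame-blocks lit compl (false ∷ p) fr = Frame-blocks (λ i → lit (suc i)) (λ i → compl (suc i)) p fr

  x+1≈y+z⇒x-z≈y-1 : ∀ {E S A} → E ⊕ 1# ≈ S ⊕ A → E ⊕ - A ≈ S ⊕ - 1#
  x+1≈y+z⇒x-z≈y-1 {E} {S} {A} E+1≈S+A = begin
    E ⊕ - A                          ≈⟨ ≈-sym (≈-trans (+-cong ≈-refl (-‿inverseʳ 1#)) (+-identityʳ _)) ⟩
    (E ⊕ - A) ⊕ (1# ⊕ - 1#)          ≈⟨ solve 4 (λ E A′ u u′ → (E :+ A′) :+ (u :+ u′) := (E :+ u) :+ (A′ :+ u′))
                                           ≈-refl E (- A) 1# (- 1#) ⟩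
    (E ⊕ 1#) ⊕ (- A ⊕ - 1#)          ≈⟨ +-cong E+1≈S+A ≈-refl ⟩
    (S ⊕ A) ⊕ (- A ⊕ - 1#)           ≈⟨ solve 4 (λ S A A′ u′ → (S :+ A) :+ (A′ :+ u′) := (S :+ u′) :+ (A :+ A′))
                                           ≈-refl S A (- A) (- 1#) ⟩
    (S ⊕ - 1#) ⊕ (A ⊕ - A)           ≈⟨ ≈-trans (+-cong ≈-refl (-‿inverseʳ A)) (+-identityʳ _) ⟩
    S ⊕ - 1#                         ∎

  evalCircuit-conclusion : ∀ (C : Circuit n) {m A S ws} →
    evaluate [] (gates C) ≡ evaluate ws (place m conclusion₀) → Frame m A S ws → ρy hypNeg ≈ - A →
    evalCircuit ρx ρy C ≈ S ⊕ - 1#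
  evalCircuit-conclusion C {A = A} {S} eq
    record { pre = pre ; D = D ; X = X ; E = E ; shape = refl ; offset = refl ; E+1≈S+A = E+1≈S+A }
    h≈-A = begin
    evalCircuit ρx ρy C   ≡⟨ evalCircuit-snoc C _ _ (trans eq ends-with-output) ⟩
    E ⊕ ρy hypNeg         ≈⟨ +-cong ≈-refl h≈-A ⟩
    E ⊕ - A               ≈⟨ x+1≈y+z⇒x-z≈y-1 E+1≈S+A ⟩
    S ⊕ - 1#              ∎
    where
    ends-with-output : evaluate (pre ++ D ∷ X ∷ E ∷ []) (place (length pre) conclusion₀)
                       ≡ (pre ++ D ∷ X ∷ E ∷ [ ρy hypNeg ]) ++ [ E ⊕ ρy hypNeg ]
    ends-with-output = trans (evaluate-place pre _ conclusion₀) (sym (++-assoc pre _ _))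

cpsGates : ∀ {n} → Subset n → Subset n → List (Gate n)
cpsGates P N = frame₀ ++ blocks positive P 0 ++ blocks negative N (∣ P ∣ * 6)
                      ++ place (∣ P ∣ * 6 + ∣ N ∣ * 6) conclusion₀

WellFormedFrom-cpsGates : ∀ {n} (P N : Subset n) → WellFormedFrom 0 (cpsGates P N)
WellFormedFrom-cpsGates {n} P N =
  tt , tt , tt ,
  WellFormedFrom-blocks-++ positive P 0
    (WellFormedFrom-blocks-++ negative N (∣ P ∣ * 6)
      (WellFormedFrom-place (∣ P ∣ * 6 + ∣ N ∣ * 6) 3 (conclusion₀ {n}) (WellFormedFrom-conclusion₀ {n})))

cpsCircuit : ∀ {n} → Subset n → Subset n → Circuit n
cpsCircuit P N = record
  { gates    = cpsGates P N
  ; nonempty = s≤s z≤n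
  ; wellForm = WellFormedFrom-cpsGates P N
  }

size-cpsCircuit : ∀ {n} (P N : Subset n) → size (cpsCircuit P N) ≡ evalPoly (5 ∷ 6 ∷ []) (∣ P ∣ + ∣ N ∣)
size-cpsCircuit {n} P N = begin
  3 + length (Bₚ ++ Bₙ ++ ending)                ≡⟨ cong (3 +_) (length-++ Bₚ) ⟩
  3 + (length Bₚ + length (Bₙ ++ ending))        ≡⟨ cong (λ l → 3 + (length Bₚ + l)) (length-++ Bₙ) ⟩
  3 + (length Bₚ + (length Bₙ + 2))              ≡⟨ cong₂ (λ p q → 3 + (p + (q + 2)))
                                                      (length-blocks positive P 0)
                                                      (length-blocks negative N (∣ P ∣ * 6)) ⟩
  3 + (∣ P ∣ * 6 + (∣ N ∣ * 6 + 2))              ≡⟨ arith ∣ P ∣ ∣ N ∣ ⟩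
  evalPoly (5 ∷ 6 ∷ []) (∣ P ∣ + ∣ N ∣)          ∎
  where
  open ≡-Reasoning
  Bₚ Bₙ ending : List (Gate n)
  Bₚ     = blocks positive P 0
  Bₙ     = blocks negative N (∣ P ∣ * 6)
  ending = place (∣ P ∣ * 6 + ∣ N ∣ * 6) conclusion₀
  arith : ∀ p q → 3 + (p * 6 + (q * 6 + 2)) ≡ 5 + (p + q) * (6 + (p + q) * 0)
  arith = solve-∀

conic-cpsCircuit : ∀ {n} (P N : Subset n) → Conic (cpsCircuit P N)
conic-cpsCircuit P N = conic-without-bad-leaves (cpsCircuit P N)
  (ℤP.≤-refl ∷ ℤP.≤-refl ∷ ℤP.≤-refl ∷
   ++⁺ (NotBadLeaf-blocks positive P 0) (++⁺ (NotBadLeaf-blocks negative N _) (tt ∷ tt ∷ [])))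

module _ {n : ℕ} (P N : Subset n) (R : CommutativeRing 0ℓ 0ℓ) (ρ : Fin n → CommutativeRing.Carrier R) where
  open CommutativeRing R
    using (0#; 1#; -_; _≈_; +-comm; +-assoc; +-abelianGroup; +-identityˡ; *-identityˡ; *-cong; +-cong)
    renaming (_+_ to _⊕_; refl to ≈-refl; sym to ≈-sym; trans to ≈-trans)
  open import Algebra.Properties.AbelianGroup +-abelianGroup using (xyx⁻¹≈y)
  open Sem R using (evalCircuit; axVal; target)
  open Evaluation R ρ (axVal P N ρ)

  complementary-positive : ∀ i → ρ i ⊕ (1# ⊕ - ρ i) ≈ 1#
  complementary-positive i = ≈-trans (≈-sym (+-assoc _ _ _)) (xyx⁻¹≈y (ρ i) 1#)

  complementary-negative : ∀ i → (1# ⊕ - ρ i) ⊕ ρ i ≈ 1#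
  complementary-negative i = ≈-trans (+-comm _ _) (complementary-positive i)

  frame-start : Frame 0 1# 0# (evaluate [] frame₀)
  frame-start = record
    { pre = [] ; D = 0# ; X = 0# ; E = 0# ; shape = refl ; offset = refl
    ; D+A≈1 = +-identityˡ 1# ; E+1≈S+A = ≈-refl }

  identity-cpsCircuit : evalCircuit ρ (axVal P N ρ) (cpsCircuit P N) ≈ target P N ρ
  identity-cpsCircuit =
    evalCircuit-conclusion (cpsCircuit P N)
      (trans (evaluate-++ _ (blocks positive P 0) _) (evaluate-++ _ (blocks negative N _) _))
      (Frame-cong refl (*-cong (*-identityˡ _) ≈-refl) (+-cong (+-identityˡ _) ≈-refl)
        (Frame-blocks negative complementary-negative N
          (Frame-blocks positive complementary-positive P frame-start)))
      ≈-refl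

cpsProof : ∀ {n} (P N : Subset n) → BoolCPSProof n P N
cpsProof P N = record
  { circuit  = cpsCircuit P N
  ; conic    = conic-cpsCircuit P N
  ; identity = identity-cpsCircuit P N
  }

-- Disjointness is not needed: an index in both P and N just contributes both of its literals.
proposition4p14 : Σ (List ℕ) λ q →
    (n : ℕ) (P N : Subset n) → Disjoint P N →
    Σ (BoolCPSProof n P N) λ π →
      size (BoolCPSProof.circuit π) ≤ evalPoly q (∣ P ∣ + ∣ N ∣)
proposition4p14 = 5 ∷ 6 ∷ [] , λ n P N _ → cpsProof P N , ℕP.≤-reflexive (size-cpsCircuit P N)
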